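{- Let $V$ be an $n$-dimensional vector space over $\mathbb{F}_2$. If $\mathcal{T}$ is a balanced triangle design in $V$, then $n$ is odd and each nonzero vector of $V$ is covered by exactly $(2^n-2)/3$ triangles of $\mathcal{T}$.
   Context: A triangle is a set $\{\langle a,b\rangle,\langle b,c\rangle,\langle c,a\rangle\}$ of $2$-dimensional subspaces with $a,b,c\in V$ linearly independent. A triangle design in $V$ is a set of triangles such that every $2$-dimensional subspace of $V$ belongs to exactly one triangle of the set. A triangle covers a nonzero vector $x$ if $x$ lies in one of its three subspaces. A triangle design is balanced if every nonzero vector of $V$ is covered by the same number of its triangles. -}

module Defs where

open import Data.Bool using (Bool; true; false; _xor_; _∨_; if_then_else_)
open import Data.Bool.Properties using () renaming (_≟_ to _≟ᵇ_)
open import Data.Nat using (ℕ; zero; suc; _+_; _*_)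
open import Data.Fin using (Fin; zero; suc)
open import Data.Vec using (Vec; []; _∷_; zipWith; replicate)
open import Data.Vec.Properties using (≡-dec)
open import Data.Product using (Σ; _×_; _,_; ∃)
open import Data.Sum using (_⊎_)
open import Relation.Nullary using (does; ¬_)
open import Relation.Binary.PropositionalEquality using (_≡_)
open import Function.Bundles using (_⇔_)

-- The n-dimensional vector space F₂ⁿ: F₂ = Bool with addition = xor.
V : ℕ → Set
V n = Vec Bool n

0v : ∀ {n} → V n
0v = replicate _ false

infixl 6 _⊕_
_⊕_ : ∀ {n} → V n → V n → V n
_⊕_ = zipWith _xor_

_·_ : ∀ {n} → Bool → V n → V n
true  · v = v
false · v = 0v

lincomb : ∀ {n k} → Vec Bool k → Vec (V n) k → V n
lincomb []       []       = 0v
lincomb (c ∷ cs) (v ∷ vs) = (c · v) ⊕ lincomb cs vs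

LinIndep : ∀ {n k} → Vec (V n) k → Set
LinIndep {k = k} vs = (cs : Vec Bool k) → lincomb cs vs ≡ 0v → cs ≡ replicate k false

InSpan : ∀ {n} → V n → V n → V n → Set
InSpan x a b = Σ Bool λ c₁ → Σ Bool λ c₂ → x ≡ (c₁ · a) ⊕ (c₂ · b)

SameSpan : ∀ {n} → V n → V n → V n → V n → Set
SameSpan {n} u v a b = (x : V n) → InSpan x u v ⇔ InSpan x a b

-- A triangle is given by a triple (a , b , c) of linearly independent
-- vectors; it is the set {⟨a,b⟩, ⟨b,c⟩, ⟨c,a⟩}.
Triple : ℕ → Set
Triple n = V n × V n × V n

IsTriangle : ∀ {n} → Triple n → Set
IsTriangle (a , b , c) = LinIndep (a ∷ b ∷ c ∷ [])

SubspaceIn : ∀ {n} → V n → V n → Triple n → Set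
SubspaceIn u v (a , b , c) = SameSpan u v a b ⊎ SameSpan u v b c ⊎ SameSpan u v c a

IsTriangleDesign : ∀ {n m} → (Fin m → Triple n) → Set
IsTriangleDesign {n} {m} T =
  ((i : Fin m) → IsTriangle (T i)) ×
  ((u v : V n) → LinIndep (u ∷ v ∷ []) →
     Σ (Fin m) (λ i → SubspaceIn u v (T i)) ×
     ((i j : Fin m) → SubspaceIn u v (T i) → SubspaceIn u v (T j) → i ≡ j))

_==_ : ∀ {n} → V n → V n → Bool
x == y = does (≡-dec _≟ᵇ_ x y)

inSpanᵇ : ∀ {n} → V n → V n → V n → Bool
inSpanᵇ x a b = (x == 0v) ∨ (x == a) ∨ (x == b) ∨ (x == (a ⊕ b))

covers : ∀ {n} → Triple n → V n → Bool
covers (a , b , c) x = inSpanᵇ x a b ∨ inSpanᵇ x b c ∨ inSpanᵇ x c a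

count : ∀ {m} → (Fin m → Bool) → ℕ
count {zero}  p = 0
count {suc m} p = (if p zero then 1 else 0) + count (λ i → p (suc i))

coverCount : ∀ {n m} → (Fin m → Triple n) → V n → ℕ
coverCount T x = count (λ i → covers (T i) x)

IsBalanced : ∀ {n m} → (Fin m → Triple n) → Set
IsBalanced {n} T = Σ ℕ λ k → (x : V n) → ¬ (x ≡ 0v) → coverCount T x ≡ k

Odd : ℕ → Set
Odd n = Σ ℕ λ k → n ≡ suc (2 * k)

{-# OPTIONS --safe #-}
module Submission where

-- Double counting.  Let N = 2ⁿ - 1 be the number of nonzero vectors and m the number of
-- triangles.  A triangle covers exactly 6 nonzero vectors, and exactly 18 ordered pairs of
-- independent vectors span one of its three subspaces; since every independent pair spans a
-- subspace lying in exactly one triangle, counting such pairs gives 18m = N(N - 1), while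
-- counting covered nonzero vectors in a balanced design with cover number k gives 6m = Nk.
-- Hence 3k = N - 1 = 2ⁿ - 2, and 2ⁿ ≡ 2 (mod 3) forces n to be odd.
-- The numbers 6 and 18 are computed in F₂³: the triangle (a, b, c) is the image of the
-- standard triangle (e₁, e₂, e₃) under the injective linear map φ sending eᵢ to a, b, c, and
-- every decidable predicate involved commutes with φ.

open import Defs
open import Data.Nat using (ℕ; _≤_; _^_; _∸_; _/_)
open import Data.Fin using (Fin)
open import Data.Product using (_×_)
open import Relation.Nullary using (¬_)
open import Relation.Binary.PropositionalEquality using (_≡_)

open import Data.Bool using (Bool; true; false; T; not; _∧_; _∨_; _xor_; if_then_else_)
open import Data.Bool.Properties using (T-∧; T-∨; xor-comm; xor-assoc; xor-identityˡ; xor-identityʳ; xor-same)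
  renaming (_≟_ to _≟ᵇ_)
open import Data.Empty using (⊥-elim)
open import Data.Fin using (zero; suc)
open import Data.Fin.Properties using (punchInᵢ≢i)
open import Data.Nat using (zero; suc; _+_; _*_; _%_; s≤s; _≟_)
open import Data.Nat.DivMod using ([m+kn]%n≡m%n; m*n/n≡m)
open import Data.Nat.Properties
  using (+-comm; +-identityʳ; *-identityˡ; *-identityʳ; *-zeroʳ; *-assoc; *-suc; *-distribʳ-+; *-cancelˡ-≡;
         ^-monoʳ-≤; m+n∸m≡n; +-*-semiring; +-commutativeSemigroup)
open import Data.Nat.Tactic.RingSolver using (solve-∀)
open import Data.Product using (∃; _,_; proj₁; proj₂)
import Data.Product as Product
open import Data.Sum using (_⊎_; inj₁; inj₂; [_,_])
import Data.Sum as Sum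
open import Data.Unit using (tt)
open import Data.Vec using (Vec; []; _∷_)
open import Data.Vec.Functional using (removeAt)
open import Data.Vec.Properties using (≡-dec; ∷-injective; zipWith-comm; zipWith-assoc; zipWith-identityˡ; zipWith-identityʳ)
open import Function using (_∘_; id; const; _⇔_; mk⇔; Equivalence)
open import Function.Definitions using (Injective)
open import Relation.Binary.PropositionalEquality using (_≢_; _≗_; refl; sym; trans; cong; cong₂; subst; module ≡-Reasoning)
open import Relation.Nullary using (yes; no)
open import Relation.Nullary.Decidable using (Dec; dec-true; dec-false)
open import Relation.Nullary.Reflects using (Reflects; ofʸ; ofⁿ; det; fromEquivalence)

open Equivalence using (to; from)
open import Algebra.Properties.CommutativeSemigroup +-commutativeSemigroup using () renaming (interchange to +-interchange)
open import Algebra.Properties.Semiring.Sum +-*-semiring using (sum; sum-cong-≗; sum-remove; sum-replicate-zero)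

𝟙 : Bool → ℕ
𝟙 b = if b then 1 else 0

𝟙-T : ∀ b → T b → 𝟙 b ≡ 1
𝟙-T true _ = refl

𝟙-¬T : ∀ b → ¬ T b → 𝟙 b ≡ 0
𝟙-¬T true  ¬tt = ⊥-elim (¬tt tt)
𝟙-¬T false _   = refl

𝟙≢0⇒T : ∀ b → 𝟙 b ≢ 0 → T b
𝟙≢0⇒T true  _   = tt
𝟙≢0⇒T false 0≢0 = 0≢0 refl

𝟙-*-cong : ∀ b {k l} → (T b → k ≡ l) → 𝟙 b * k ≡ 𝟙 b * l
𝟙-*-cong true  k≡l = cong (1 *_) (k≡l tt)
𝟙-*-cong false _   = refl

𝟙-split : ∀ b e → (T e → T b) → 𝟙 b ≡ 𝟙 (b ∧ not e) + 𝟙 e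
𝟙-split true  true  _ = refl
𝟙-split true  false _ = refl
𝟙-split false false _ = refl
𝟙-split false true  e⇒b = ⊥-elim (e⇒b tt)

T-∨³ : ∀ {p q r} → T (p ∨ q ∨ r) ⇔ (T p ⊎ T q ⊎ T r)
T-∨³ {true}          = mk⇔ inj₁ (const tt)
T-∨³ {false} {true}  = mk⇔ (inj₂ ∘ inj₁) (const tt)
T-∨³ {false} {false} = mk⇔ (inj₂ ∘ inj₂) [ (λ ()) , [ (λ ()) , id ] ]

==-reflects : ∀ {n} (x y : V n) → Reflects (x ≡ y) (x == y)
==-reflects x y = Dec.proof (≡-dec _≟ᵇ_ x y)

==⇒≡ : ∀ {n} {x y : V n} → T (x == y) → x ≡ y
==⇒≡ {x = x} {y} t with x == y | ==-reflects x y
... | true | ofʸ x≡y = x≡y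

≡⇒== : ∀ {n} {x y : V n} → x ≡ y → T (x == y)
≡⇒== {x = x} refl with x == x | ==-reflects x x
... | true  | _        = tt
... | false | ofⁿ x≢x = x≢x refl

==-refl : ∀ {n} (x : V n) → x == x ≡ true
==-refl x = dec-true (≡-dec _≟ᵇ_ x x) refl

≢⇒==-false : ∀ {n} {x y : V n} → x ≢ y → x == y ≡ false
≢⇒==-false {x = x} {y} = dec-false (≡-dec _≟ᵇ_ x y)

==-sym : ∀ {n} (x y : V n) → (x == y) ≡ (y == x)
==-sym x y = det (fromEquivalence (sym ∘ ==⇒≡) (≡⇒== ∘ sym)) (==-reflects y x)

not-==⇒≢ : ∀ {n} {x y : V n} → T (not (x == y)) → x ≢ y
not-==⇒≢ {x = x} {y} t with x == y | ==-reflects x y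
... | false | ofⁿ x≢y = x≢y

⊕-comm : ∀ {n} (x y : V n) → x ⊕ y ≡ y ⊕ x
⊕-comm = zipWith-comm xor-comm

⊕-assoc : ∀ {n} (x y z : V n) → (x ⊕ y) ⊕ z ≡ x ⊕ (y ⊕ z)
⊕-assoc = zipWith-assoc xor-assoc

⊕-identityˡ : ∀ {n} (x : V n) → 0v ⊕ x ≡ x
⊕-identityˡ = zipWith-identityˡ xor-identityˡ

⊕-identityʳ : ∀ {n} (x : V n) → x ⊕ 0v ≡ x
⊕-identityʳ = zipWith-identityʳ xor-identityʳ

⊕-self : ∀ {n} (x : V n) → x ⊕ x ≡ 0v
⊕-self []      = refl
⊕-self (b ∷ x) = cong₂ _∷_ (xor-same b) (⊕-self x)

⊕≡0⇒≡ : ∀ {n} {x y : V n} → x ⊕ y ≡ 0v → x ≡ y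
⊕≡0⇒≡ {x = x} {y} x⊕y≡0 = begin
  x             ≡⟨ sym (⊕-identityʳ x) ⟩
  x ⊕ 0v        ≡⟨ cong (x ⊕_) (sym (⊕-self y)) ⟩
  x ⊕ (y ⊕ y)   ≡⟨ sym (⊕-assoc x y y) ⟩
  (x ⊕ y) ⊕ y   ≡⟨ cong (_⊕ y) x⊕y≡0 ⟩
  0v ⊕ y        ≡⟨ ⊕-identityˡ y ⟩
  y             ∎
  where open ≡-Reasoning

⊕-interchange : ∀ {n} (w x y z : V n) → (w ⊕ x) ⊕ (y ⊕ z) ≡ (w ⊕ y) ⊕ (x ⊕ z)
⊕-interchange w x y z = begin
  (w ⊕ x) ⊕ (y ⊕ z)   ≡⟨ ⊕-assoc w x (y ⊕ z) ⟩
  w ⊕ (x ⊕ (y ⊕ z))   ≡⟨ cong (w ⊕_) (sym (⊕-assoc x y z)) ⟩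
  w ⊕ ((x ⊕ y) ⊕ z)   ≡⟨ cong (λ v → w ⊕ (v ⊕ z)) (⊕-comm x y) ⟩
  w ⊕ ((y ⊕ x) ⊕ z)   ≡⟨ cong (w ⊕_) (⊕-assoc y x z) ⟩
  w ⊕ (y ⊕ (x ⊕ z))   ≡⟨ sym (⊕-assoc w y (x ⊕ z)) ⟩
  (w ⊕ y) ⊕ (x ⊕ z)   ∎
  where open ≡-Reasoning

·-distribʳ-xor : ∀ {n} c d (v : V n) → (c xor d) · v ≡ c · v ⊕ d · v
·-distribʳ-xor true  true  v = sym (⊕-self v)
·-distribʳ-xor true  false v = sym (⊕-identityʳ v)
·-distribʳ-xor false d     v = sym (⊕-identityˡ (d · v))

lincomb-⊕ : ∀ {n k} (cs ds : Vec Bool k) (vs : Vec (V n) k) →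
            lincomb (cs ⊕ ds) vs ≡ lincomb cs vs ⊕ lincomb ds vs
lincomb-⊕ []       []       []       = sym (⊕-self 0v)
lincomb-⊕ (c ∷ cs) (d ∷ ds) (v ∷ vs) = begin
  (c xor d) · v ⊕ lincomb (cs ⊕ ds) vs
    ≡⟨ cong₂ _⊕_ (·-distribʳ-xor c d v) (lincomb-⊕ cs ds vs) ⟩
  (c · v ⊕ d · v) ⊕ (lincomb cs vs ⊕ lincomb ds vs)
    ≡⟨ ⊕-interchange (c · v) (d · v) (lincomb cs vs) (lincomb ds vs) ⟩
  (c · v ⊕ lincomb cs vs) ⊕ (d · v ⊕ lincomb ds vs) ∎
  where open ≡-Reasoning

lincomb-0v : ∀ {n k} (vs : Vec (V n) k) → lincomb 0v vs ≡ 0v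
lincomb-0v []       = refl
lincomb-0v (v ∷ vs) = trans (⊕-identityˡ _) (lincomb-0v vs)

∑V : ∀ n → (V n → ℕ) → ℕ
∑V zero    f = f []
∑V (suc n) f = ∑V n (f ∘ (true ∷_)) + ∑V n (f ∘ (false ∷_))

∑V-cong : ∀ n {f g : V n → ℕ} → f ≗ g → ∑V n f ≡ ∑V n g
∑V-cong zero    f≗g = f≗g []
∑V-cong (suc n) f≗g = cong₂ _+_ (∑V-cong n (f≗g ∘ (true ∷_))) (∑V-cong n (f≗g ∘ (false ∷_)))

∑V-zero : ∀ n {f : V n → ℕ} → (∀ x → f x ≡ 0) → ∑V n f ≡ 0
∑V-zero zero    f≗0 = f≗0 []
∑V-zero (suc n) f≗0 = cong₂ _+_ (∑V-zero n (f≗0 ∘ (true ∷_))) (∑V-zero n (f≗0 ∘ (false ∷_)))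

∑V-distrib-+ : ∀ n (f g : V n → ℕ) → ∑V n (λ x → f x + g x) ≡ ∑V n f + ∑V n g
∑V-distrib-+ zero    f g = refl
∑V-distrib-+ (suc n) f g =
  trans (cong₂ _+_ (∑V-distrib-+ n _ _) (∑V-distrib-+ n _ _))
        (+-interchange (∑V n (f ∘ (true ∷_))) _ _ _)

∑V-*ʳ : ∀ n (f : V n → ℕ) c → ∑V n (λ x → f x * c) ≡ ∑V n f * c
∑V-*ʳ zero    f c = refl
∑V-*ʳ (suc n) f c =
  trans (cong₂ _+_ (∑V-*ʳ n _ c) (∑V-*ʳ n _ c)) (sym (*-distribʳ-+ c (∑V n (f ∘ (true ∷_))) _))

∑V-one : ∀ n → ∑V n (λ _ → 1) ≡ 2 ^ n
∑V-one zero    = refl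
∑V-one (suc n) = trans (cong₂ _+_ (∑V-one n) (∑V-one n)) (cong (2 ^ n +_) (sym (+-identityʳ (2 ^ n))))

∑V-comm : ∀ n k (f : V n → V k → ℕ) → ∑V n (λ x → ∑V k (f x)) ≡ ∑V k (λ y → ∑V n (λ x → f x y))
∑V-comm zero    k f = refl
∑V-comm (suc n) k f = trans (cong₂ _+_ (∑V-comm n k _) (∑V-comm n k _)) (sym (∑V-distrib-+ k _ _))

∑V-sum-comm : ∀ n {m} (f : V n → Fin m → ℕ) → ∑V n (λ x → sum (f x)) ≡ sum (λ i → ∑V n (λ x → f x i))
∑V-sum-comm n {zero}  f = ∑V-zero n (λ _ → refl)
∑V-sum-comm n {suc m} f =
  trans (∑V-distrib-+ n _ _) (cong (∑V n (λ x → f x zero) +_) (∑V-sum-comm n (λ x → f x ∘ suc)))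

∑V-point : ∀ n (y : V n) (f : V n → ℕ) → (∀ x → x ≢ y → f x ≡ 0) → ∑V n f ≡ f y
∑V-point zero    []       f _      = refl
∑V-point (suc n) (true ∷ y) f vanish =
  trans (cong₂ _+_ (∑V-point n y _ (λ x x≢y → vanish _ (x≢y ∘ proj₂ ∘ ∷-injective)))
                   (∑V-zero n (λ x → vanish _ (λ ()))))
        (+-identityʳ _)
∑V-point (suc n) (false ∷ y) f vanish =
  cong₂ _+_ (∑V-zero n (λ x → vanish _ (λ ())))
            (∑V-point n y _ (λ x x≢y → vanish _ (x≢y ∘ proj₂ ∘ ∷-injective)))

∑V-𝟙-== : ∀ n (x : V n) → ∑V n (λ y → 𝟙 (x == y)) ≡ 1
∑V-𝟙-== n x = trans (∑V-point n x _ (λ y y≢x → cong 𝟙 (≢⇒==-false (y≢x ∘ sym)))) (cong 𝟙 (==-refl x))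

∑V-𝟙-∧ : ∀ n b (p : V n → Bool) → ∑V n (λ x → 𝟙 (b ∧ p x)) ≡ 𝟙 b * ∑V n (𝟙 ∘ p)
∑V-𝟙-∧ n true  p = sym (*-identityˡ _)
∑V-𝟙-∧ n false p = ∑V-zero n (λ _ → refl)

∑V-witness : ∀ n (f : V n → ℕ) → ∑V n f ≢ 0 → ∃ λ x → f x ≢ 0
∑V-witness zero    f ∑≢0 = [] , ∑≢0
∑V-witness (suc n) f ∑≢0 with ∑V n (f ∘ (true ∷_)) ≟ 0
... | no  ∑₁≢0 = let x , fx≢0 = ∑V-witness n _ ∑₁≢0 in true ∷ x , fx≢0
... | yes ∑₁≡0 = let x , fx≢0 = ∑V-witness n _ (∑≢0 ∘ cong₂ _+_ ∑₁≡0) in false ∷ x , fx≢0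

∑V-injective : ∀ {k n} (ψ : V k → V n) → Injective _≡_ _≡_ ψ → (g : V n → ℕ) →
               (∀ x → g x ≢ 0 → ∃ λ u → ψ u ≡ x) → ∑V n g ≡ ∑V k (g ∘ ψ)
∑V-injective {k} {n} ψ ψ-injective g supported = begin
  ∑V n g                                          ≡⟨ ∑V-cong n fibre ⟩
  ∑V n (λ x → ∑V k (λ u → 𝟙 (ψ u == x) * g x))    ≡⟨ ∑V-comm n k _ ⟩
  ∑V k (λ u → ∑V n (λ x → 𝟙 (ψ u == x) * g x))    ≡⟨ ∑V-cong k (λ u → ∑V-point n (ψ u) _ (off-graph u)) ⟩
  ∑V k (λ u → 𝟙 (ψ u == ψ u) * g (ψ u))           ≡⟨ ∑V-cong k (on-graph ∘ ψ) ⟩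
  ∑V k (g ∘ ψ)                                    ∎
  where
  open ≡-Reasoning
  on-graph : ∀ x → 𝟙 (x == x) * g x ≡ g x
  on-graph x = trans (cong (λ b → 𝟙 b * g x) (==-refl x)) (*-identityˡ (g x))
  off-graph : ∀ u x → x ≢ ψ u → 𝟙 (ψ u == x) * g x ≡ 0
  off-graph u x x≢ψu = cong (λ b → 𝟙 b * g x) (≢⇒==-false (x≢ψu ∘ sym))
  fibre : ∀ x → g x ≡ ∑V k (λ u → 𝟙 (ψ u == x) * g x)
  fibre x with g x ≟ 0 | supported x
  ... | yes gx≡0 | _ =
    trans gx≡0 (sym (∑V-zero k (λ u → trans (cong (𝟙 (ψ u == x) *_) gx≡0) (*-zeroʳ (𝟙 (ψ u == x))))))
  ... | no  gx≢0 | x∈im with x∈im gx≢0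
  ... | u₀ , refl = sym (trans (∑V-point k u₀ _ (λ u u≢u₀ → off-graph u (ψ u₀) (u≢u₀ ∘ ψ-injective ∘ sym)))
                               (on-graph (ψ u₀)))

sum-const : ∀ m c → sum {m} (λ _ → c) ≡ m * c
sum-const zero    c = refl
sum-const (suc m) c = cong (c +_) (sum-const m c)

sum-point : ∀ {m} (f : Fin m → ℕ) (i : Fin m) → (∀ j → j ≢ i → f j ≡ 0) → sum f ≡ f i
sum-point {suc m} f i vanish = begin
  sum f                     ≡⟨ sum-remove {i = i} f ⟩
  f i + sum (removeAt f i)  ≡⟨ cong (f i +_) (sum-cong-≗ (λ j → vanish _ (punchInᵢ≢i i j))) ⟩
  f i + sum {m} (λ _ → 0)   ≡⟨ cong (f i +_) (sum-replicate-zero m) ⟩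
  f i + 0                   ≡⟨ +-identityʳ (f i) ⟩
  f i                       ∎
  where open ≡-Reasoning

sum-𝟙-∧ : ∀ {m} b (p : Fin m → Bool) → sum (λ i → 𝟙 (b ∧ p i)) ≡ 𝟙 b * sum (𝟙 ∘ p)
sum-𝟙-∧ true  p = sym (*-identityˡ _)
sum-𝟙-∧ {m} false p = sum-replicate-zero m

count≡sum : ∀ {m} (p : Fin m → Bool) → count p ≡ sum (𝟙 ∘ p)
count≡sum {zero}  p = refl
count≡sum {suc m} p = cong (𝟙 (p zero) +_) (count≡sum (p ∘ suc))

inSpanᵇ⇒ : ∀ {n} (x a b : V n) → T (inSpanᵇ x a b) → x ≡ 0v ⊎ x ≡ a ⊎ x ≡ b ⊎ x ≡ a ⊕ b
inSpanᵇ⇒ x a b =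
  Sum.map ==⇒≡ (Sum.map ==⇒≡ (Sum.map ==⇒≡ ==⇒≡))
    ∘ Sum.map₂ (to (T-∨³ {x == a} {x == b})) ∘ to (T-∨ {x == 0v})

inSpanᵇ⇐ : ∀ {n} (x a b : V n) → x ≡ 0v ⊎ x ≡ a ⊎ x ≡ b ⊎ x ≡ a ⊕ b → T (inSpanᵇ x a b)
inSpanᵇ⇐ x a b =
  from (T-∨ {x == 0v}) ∘ Sum.map₂ (from (T-∨³ {x == a} {x == b}))
    ∘ Sum.map ≡⇒== (Sum.map ≡⇒== (Sum.map ≡⇒== ≡⇒==))

nonzero : ∀ {n} → V n → Bool
nonzero x = not (x == 0v)

independent : ∀ {n} → V n → V n → Bool
independent x y = nonzero x ∧ nonzero y ∧ not (x == y)

inSubspaceOf : ∀ {n} → Triple n → V n → V n → Bool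
inSubspaceOf (a , b , c) x y =
  (inSpanᵇ x a b ∧ inSpanᵇ y a b) ∨ (inSpanᵇ x b c ∧ inSpanᵇ y b c) ∨ (inSpanᵇ x c a ∧ inSpanᵇ y c a)

-- ⟨u, w⟩ = {0v, u, w, u ⊕ w}, and 0v lies in every span.
span⊆ᵇ : ∀ {n} → V n → V n → V n → V n → Bool
span⊆ᵇ u w a b = inSpanᵇ u a b ∧ inSpanᵇ w a b ∧ inSpanᵇ (u ⊕ w) a b

sameSpanᵇ : ∀ {n} → V n → V n → V n → V n → Bool
sameSpanᵇ u w a b = span⊆ᵇ u w a b ∧ span⊆ᵇ a b u w

subspaceInᵇ : ∀ {n} → V n → V n → Triple n → Bool
subspaceInᵇ u w (a , b , c) = sameSpanᵇ u w a b ∨ sameSpanᵇ u w b c ∨ sameSpanᵇ u w c a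

independent⇒ : ∀ {n} (x y : V n) → T (independent x y) → x ≢ 0v × y ≢ 0v × x ≢ y
independent⇒ x y indep =
  let x≠0 , y≠0∧x≠y = to (T-∧ {nonzero x}) indep
      y≠0 , x≠y     = to (T-∧ {nonzero y}) y≠0∧x≠y
  in not-==⇒≢ x≠0 , not-==⇒≢ y≠0 , not-==⇒≢ x≠y

independent⇒LinIndep : ∀ {n} (x y : V n) → T (independent x y) → LinIndep (x ∷ y ∷ [])
independent⇒LinIndep x y indep = λ where
    (true  ∷ true  ∷ []) x⊕y⊕0≡0 →
      ⊥-elim (x≢y (⊕≡0⇒≡ (trans (cong (x ⊕_) (sym (⊕-identityʳ y))) x⊕y⊕0≡0)))
    (true  ∷ false ∷ []) x⊕0⊕0≡0 →
      ⊥-elim (x≢0 (trans (sym (⊕-identityʳ x)) (trans (cong (x ⊕_) (sym (⊕-identityʳ 0v))) x⊕0⊕0≡0)))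
    (false ∷ true  ∷ []) 0⊕y⊕0≡0 →
      ⊥-elim (y≢0 (trans (sym (⊕-identityʳ y)) (trans (sym (⊕-identityˡ _)) 0⊕y⊕0≡0)))
    (false ∷ false ∷ []) _       → refl
  where
  x≢0 = proj₁ (independent⇒ x y indep)
  y≢0 = proj₁ (proj₂ (independent⇒ x y indep))
  x≢y = proj₂ (proj₂ (independent⇒ x y indep))

InSpan⇒inSpanᵇ : ∀ {n} (x a b : V n) → InSpan x a b → T (inSpanᵇ x a b)
InSpan⇒inSpanᵇ x a b (false , false , x≡0⊕0) = inSpanᵇ⇐ x a b (inj₁ (trans x≡0⊕0 (⊕-identityʳ 0v)))
InSpan⇒inSpanᵇ x a b (true  , false , x≡a⊕0) = inSpanᵇ⇐ x a b (inj₂ (inj₁ (trans x≡a⊕0 (⊕-identityʳ a))))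
InSpan⇒inSpanᵇ x a b (false , true  , x≡0⊕b) = inSpanᵇ⇐ x a b (inj₂ (inj₂ (inj₁ (trans x≡0⊕b (⊕-identityˡ b)))))
InSpan⇒inSpanᵇ x a b (true  , true  , x≡a⊕b) = inSpanᵇ⇐ x a b (inj₂ (inj₂ (inj₂ x≡a⊕b)))

inSpanᵇ⇒InSpan : ∀ {n} (x a b : V n) → T (inSpanᵇ x a b) → InSpan x a b
inSpanᵇ⇒InSpan x a b x∈ with inSpanᵇ⇒ x a b x∈
... | inj₁ refl               = false , false , sym (⊕-identityʳ 0v)
... | inj₂ (inj₁ refl)        = true  , false , sym (⊕-identityʳ a)
... | inj₂ (inj₂ (inj₁ refl)) = false , true  , sym (⊕-identityˡ b)
... | inj₂ (inj₂ (inj₂ refl)) = true  , true  , refl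

span⊆ᵇ-sound : ∀ {n} (u w a b z : V n) → T (span⊆ᵇ u w a b) → T (inSpanᵇ z u w) → T (inSpanᵇ z a b)
span⊆ᵇ-sound u w a b z ⊆ z∈ with inSpanᵇ⇒ z u w z∈ | to (T-∧ {inSpanᵇ u a b}) ⊆
... | inj₁ refl               | _           = inSpanᵇ⇐ 0v a b (inj₁ refl)
... | inj₂ (inj₁ refl)        | u∈ , _      = u∈
... | inj₂ (inj₂ (inj₁ refl)) | _ , w∈,u⊕w∈ = proj₁ (to (T-∧ {inSpanᵇ w a b}) w∈,u⊕w∈)
... | inj₂ (inj₂ (inj₂ refl)) | _ , w∈,u⊕w∈ = proj₂ (to (T-∧ {inSpanᵇ w a b}) w∈,u⊕w∈)

sameSpanᵇ⇒SameSpan : ∀ {n} {u w a b : V n} → T (sameSpanᵇ u w a b) → SameSpan u w a b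
sameSpanᵇ⇒SameSpan {u = u} {w} {a} {b} same x = mk⇔ (transport uw⊆ab) (transport ab⊆uw)
  where
  uw⊆ab = proj₁ (to (T-∧ {span⊆ᵇ u w a b}) same)
  ab⊆uw = proj₂ (to (T-∧ {span⊆ᵇ u w a b}) same)
  transport : ∀ {p q r s} → T (span⊆ᵇ p q r s) → InSpan x p q → InSpan x r s
  transport {p} {q} {r} {s} ⊆ = inSpanᵇ⇒InSpan x r s ∘ span⊆ᵇ-sound p q r s x ⊆ ∘ InSpan⇒inSpanᵇ x p q

subspaceInᵇ⇒SubspaceIn : ∀ {n} {u w : V n} (t : Triple n) → T (subspaceInᵇ u w t) → SubspaceIn u w t
subspaceInᵇ⇒SubspaceIn {u = u} {w} (a , b , c) subspace
  with to (T-∨³ {sameSpanᵇ u w a b} {sameSpanᵇ u w b c}) subspace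
... | inj₁ ab        = inj₁ (sameSpanᵇ⇒SameSpan ab)
... | inj₂ (inj₁ bc) = inj₂ (inj₁ (sameSpanᵇ⇒SameSpan bc))
... | inj₂ (inj₂ ca) = inj₂ (inj₂ (sameSpanᵇ⇒SameSpan ca))

SubspaceIn⇒inSubspaceOf : ∀ {n} {x y : V n} (t : Triple n) → SubspaceIn x y t → T (inSubspaceOf t x y)
SubspaceIn⇒inSubspaceOf {x = x} {y} (a , b , c) =
  from (T-∨³ {inSpanᵇ x a b ∧ inSpanᵇ y a b} {inSpanᵇ x b c ∧ inSpanᵇ y b c})
    ∘ Sum.map both-in (Sum.map both-in both-in)
  where
  both-in : ∀ {a b} → SameSpan x y a b → T (inSpanᵇ x a b ∧ inSpanᵇ y a b)
  both-in {a} {b} same = from T-∧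
    ( InSpan⇒inSpanᵇ x a b (to (same x) (true , false , sym (⊕-identityʳ x)))
    , InSpan⇒inSpanᵇ y a b (to (same y) (false , true , sym (⊕-identityˡ y))) )

covers⇔ : ∀ {n} (x a b c : V n) →
          T (covers (a , b , c) x) ⇔ (T (inSpanᵇ x a b) ⊎ T (inSpanᵇ x b c) ⊎ T (inSpanᵇ x c a))
covers⇔ x a b c = T-∨³ {inSpanᵇ x a b} {inSpanᵇ x b c}

inSubspaceOf⇒covers : ∀ {n} (t : Triple n) (x y : V n) → T (inSubspaceOf t x y) → T (covers t x) × T (covers t y)
inSubspaceOf⇒covers (a , b , c) x y flag
  with to (T-∨³ {inSpanᵇ x a b ∧ inSpanᵇ y a b} {inSpanᵇ x b c ∧ inSpanᵇ y b c}) flag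
... | inj₁ ab        = Product.map (from (covers⇔ x a b c) ∘ inj₁)
                                   (from (covers⇔ y a b c) ∘ inj₁)
                                   (to (T-∧ {inSpanᵇ x a b}) ab)
... | inj₂ (inj₁ bc) = Product.map (from (covers⇔ x a b c) ∘ inj₂ ∘ inj₁)
                                   (from (covers⇔ y a b c) ∘ inj₂ ∘ inj₁)
                                   (to (T-∧ {inSpanᵇ x b c}) bc)
... | inj₂ (inj₂ ca) = Product.map (from (covers⇔ x a b c) ∘ inj₂ ∘ inj₂)
                                   (from (covers⇔ y a b c) ∘ inj₂ ∘ inj₂)
                                   (to (T-∧ {inSpanᵇ x c a}) ca)

basisOfSide : ∀ {n} → Triple n → V n → V n → Bool
basisOfSide t x y = independent x y ∧ inSubspaceOf t x y

basisOfSide⇒covers : ∀ {n} (t : Triple n) (x y : V n) → T (basisOfSide t x y) → T (covers t x) × T (covers t y)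
basisOfSide⇒covers t x y = inSubspaceOf⇒covers t x y ∘ proj₂ ∘ to (T-∧ {independent x y})

e₁ e₂ e₃ : V 3
e₁ = true  ∷ false ∷ false ∷ []
e₂ = false ∷ true  ∷ false ∷ []
e₃ = false ∷ false ∷ true  ∷ []

standard : Triple 3
standard = e₁ , e₂ , e₃

allV : ∀ k → (V k → Bool) → Bool
allV zero    f = f []
allV (suc k) f = allV k (f ∘ (true ∷_)) ∧ allV k (f ∘ (false ∷_))

allV-sound : ∀ k (f : V k → Bool) → T (allV k f) → ∀ u → T (f u)
allV-sound zero    f all [] = all
allV-sound (suc k) f all (true  ∷ u) = allV-sound k _ (proj₁ (to (T-∧ {allV k (f ∘ (true ∷_))}) all)) u
allV-sound (suc k) f all (false ∷ u) = allV-sound k _ (proj₂ (to (T-∧ {allV k (f ∘ (true ∷_))}) all)) u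

standard-covered-count : ∑V 3 (λ u → 𝟙 (nonzero u ∧ covers standard u)) ≡ 6
standard-covered-count = refl

standard-basis-count : ∑V 3 (λ u → ∑V 3 (λ w → 𝟙 (basisOfSide standard u w))) ≡ 18
standard-basis-count = refl

standard-basis⇒subspace : ∀ u w → T (basisOfSide standard u w) → T (subspaceInᵇ u w standard)
standard-basis⇒subspace u w = modus-ponens (allV-sound 3 (check u) (allV-sound 3 (allV 3 ∘ check) tt u) w)
  where
  check : V 3 → V 3 → Bool
  check u w = not (basisOfSide standard u w) ∨ subspaceInᵇ u w standard
  modus-ponens : ∀ {p q} → T (not p ∨ q) → T p → T q
  modus-ponens {true} q _ = q

module Embedding {n} (a b c : V n) (abc-independent : LinIndep (a ∷ b ∷ c ∷ [])) where

  φ : V 3 → V n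
  φ u = lincomb u (a ∷ b ∷ c ∷ [])

  φ-⊕ : ∀ u w → φ (u ⊕ w) ≡ φ u ⊕ φ w
  φ-⊕ u w = lincomb-⊕ u w (a ∷ b ∷ c ∷ [])

  φ-0v : φ 0v ≡ 0v
  φ-0v = lincomb-0v (a ∷ b ∷ c ∷ [])

  φ-injective : Injective _≡_ _≡_ φ
  φ-injective {u} {w} φu≡φw =
    ⊕≡0⇒≡ (abc-independent (u ⊕ w) (trans (φ-⊕ u w) (trans (cong (_⊕ φ w) φu≡φw) (⊕-self (φ w)))))

  φ³ : Triple 3 → Triple n
  φ³ (p , q , r) = φ p , φ q , φ r

  φ-standard : φ³ standard ≡ (a , b , c)
  φ-standard = cong₂ _,_ φe₁≡a (cong₂ _,_ φe₂≡b φe₃≡c)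
    where
    φe₁≡a = trans (cong (a ⊕_) (lincomb-0v (b ∷ c ∷ []))) (⊕-identityʳ a)
    φe₂≡b = trans (⊕-identityˡ (b ⊕ (0v ⊕ 0v))) (trans (cong (b ⊕_) (⊕-identityʳ 0v)) (⊕-identityʳ b))
    φe₃≡c = trans (⊕-identityˡ (0v ⊕ (c ⊕ 0v))) (trans (⊕-identityˡ (c ⊕ 0v)) (⊕-identityʳ c))

  φ-== : ∀ u w → (φ u == φ w) ≡ (u == w)
  φ-== u w = det (fromEquivalence (φ-injective ∘ ==⇒≡) (≡⇒== ∘ cong φ)) (==-reflects u w)

  φ-==0v : ∀ u → (φ u == 0v) ≡ (u == 0v)
  φ-==0v u = trans (cong (φ u ==_) (sym φ-0v)) (φ-== u 0v)

  nonzero-φ : ∀ u → nonzero (φ u) ≡ nonzero u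
  nonzero-φ u = cong not (φ-==0v u)

  independent-φ : ∀ u w → independent (φ u) (φ w) ≡ independent u w
  independent-φ u w = cong₂ _∧_ (nonzero-φ u) (cong₂ _∧_ (nonzero-φ w) (cong not (φ-== u w)))

  inSpanᵇ-φ : ∀ x p q → inSpanᵇ (φ x) (φ p) (φ q) ≡ inSpanᵇ x p q
  inSpanᵇ-φ x p q =
    cong₂ _∨_ (φ-==0v x) (cong₂ _∨_ (φ-== x p) (cong₂ _∨_ (φ-== x q)
      (trans (cong (φ x ==_) (sym (φ-⊕ p q))) (φ-== x (p ⊕ q)))))

  covers-φ : ∀ t u → covers (φ³ t) (φ u) ≡ covers t u
  covers-φ (p , q , r) u = cong₂ _∨_ (inSpanᵇ-φ u p q) (cong₂ _∨_ (inSpanᵇ-φ u q r) (inSpanᵇ-φ u r p))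

  basisOfSide-φ : ∀ t u w → basisOfSide (φ³ t) (φ u) (φ w) ≡ basisOfSide t u w
  basisOfSide-φ (p , q , r) u w = cong₂ _∧_ (independent-φ u w)
    (cong₂ _∨_ (both p q) (cong₂ _∨_ (both q r) (both r p)))
    where both = λ p q → cong₂ _∧_ (inSpanᵇ-φ u p q) (inSpanᵇ-φ w p q)

  span⊆ᵇ-φ : ∀ u w p q → span⊆ᵇ (φ u) (φ w) (φ p) (φ q) ≡ span⊆ᵇ u w p q
  span⊆ᵇ-φ u w p q = cong₂ _∧_ (inSpanᵇ-φ u p q) (cong₂ _∧_ (inSpanᵇ-φ w p q)
    (trans (cong (λ z → inSpanᵇ z (φ p) (φ q)) (sym (φ-⊕ u w))) (inSpanᵇ-φ (u ⊕ w) p q)))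

  subspaceInᵇ-φ : ∀ t u w → subspaceInᵇ (φ u) (φ w) (φ³ t) ≡ subspaceInᵇ u w t
  subspaceInᵇ-φ (p , q , r) u w = cong₂ _∨_ (same p q) (cong₂ _∨_ (same q r) (same r p))
    where same = λ p q → cong₂ _∧_ (span⊆ᵇ-φ u w p q) (span⊆ᵇ-φ p q u w)

  inSpanᵇ-image : ∀ x p q → T (inSpanᵇ x (φ p) (φ q)) → ∃ λ u → φ u ≡ x
  inSpanᵇ-image x p q x∈ with inSpanᵇ⇒ x (φ p) (φ q) x∈
  ... | inj₁ refl               = 0v , φ-0v
  ... | inj₂ (inj₁ refl)        = p , refl
  ... | inj₂ (inj₂ (inj₁ refl)) = q , refl
  ... | inj₂ (inj₂ (inj₂ refl)) = p ⊕ q , φ-⊕ p q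

  covers-image : ∀ t x → T (covers (φ³ t) x) → ∃ λ u → φ u ≡ x
  covers-image (p , q , r) x =
    [ inSpanᵇ-image x p q , [ inSpanᵇ-image x q r , inSpanᵇ-image x r p ] ] ∘ to (covers⇔ x (φ p) (φ q) (φ r))

  covered-count : ∑V n (λ x → 𝟙 (nonzero x ∧ covers (a , b , c) x)) ≡ 6
  covered-count = begin
    ∑V n (λ x → 𝟙 (nonzero x ∧ covers (a , b , c) x))
      ≡⟨ cong (λ t → ∑V n (λ x → 𝟙 (nonzero x ∧ covers t x))) (sym φ-standard) ⟩
    ∑V n (λ x → 𝟙 (nonzero x ∧ covers (φ³ standard) x))
      ≡⟨ ∑V-injective φ φ-injective _ supported ⟩
    ∑V 3 (λ u → 𝟙 (nonzero (φ u) ∧ covers (φ³ standard) (φ u)))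
      ≡⟨ ∑V-cong 3 (λ u → cong₂ (λ p q → 𝟙 (p ∧ q)) (nonzero-φ u) (covers-φ standard u)) ⟩
    ∑V 3 (λ u → 𝟙 (nonzero u ∧ covers standard u))
      ≡⟨ standard-covered-count ⟩
    6 ∎
    where
    open ≡-Reasoning
    supported : ∀ x → 𝟙 (nonzero x ∧ covers (φ³ standard) x) ≢ 0 → ∃ λ u → φ u ≡ x
    supported x = covers-image standard x ∘ proj₂ ∘ to (T-∧ {nonzero x}) ∘ 𝟙≢0⇒T _

  basis-count : ∑V n (λ x → ∑V n (λ y → 𝟙 (basisOfSide (a , b , c) x y))) ≡ 18
  basis-count = begin
    ∑V n (λ x → ∑V n (λ y → 𝟙 (basisOfSide (a , b , c) x y)))
      ≡⟨ cong (λ t → ∑V n (λ x → ∑V n (λ y → 𝟙 (basisOfSide t x y)))) (sym φ-standard) ⟩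
    ∑V n (λ x → ∑V n (λ y → 𝟙 (basisOfSide (φ³ standard) x y)))
      ≡⟨ ∑V-injective φ φ-injective _ first-supported ⟩
    ∑V 3 (λ u → ∑V n (λ y → 𝟙 (basisOfSide (φ³ standard) (φ u) y)))
      ≡⟨ ∑V-cong 3 (λ u → ∑V-injective φ φ-injective _ (second-supported (φ u))) ⟩
    ∑V 3 (λ u → ∑V 3 (λ w → 𝟙 (basisOfSide (φ³ standard) (φ u) (φ w))))
      ≡⟨ ∑V-cong 3 (λ u → ∑V-cong 3 (λ w → cong 𝟙 (basisOfSide-φ standard u w))) ⟩
    ∑V 3 (λ u → ∑V 3 (λ w → 𝟙 (basisOfSide standard u w)))
      ≡⟨ standard-basis-count ⟩
    18 ∎
    where
    open ≡-Reasoning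
    second-supported : ∀ x y → 𝟙 (basisOfSide (φ³ standard) x y) ≢ 0 → ∃ λ w → φ w ≡ y
    second-supported x y = covers-image standard y ∘ proj₂ ∘ basisOfSide⇒covers (φ³ standard) x y ∘ 𝟙≢0⇒T _
    first-supported : ∀ x → ∑V n (λ y → 𝟙 (basisOfSide (φ³ standard) x y)) ≢ 0 → ∃ λ u → φ u ≡ x
    first-supported x ∑≢0 =
      let y , 𝟙≢0 = ∑V-witness n _ ∑≢0
      in covers-image standard x (proj₁ (basisOfSide⇒covers (φ³ standard) x y (𝟙≢0⇒T _ 𝟙≢0)))

  basisOfSide⇒SubspaceIn : ∀ x y → T (basisOfSide (a , b , c) x y) → SubspaceIn x y (a , b , c)
  basisOfSide⇒SubspaceIn x y basis =
    subst (SubspaceIn x y) φ-standard (lift x y (subst (λ t → T (basisOfSide t x y)) (sym φ-standard) basis))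
    where
    lift : ∀ x y → T (basisOfSide (φ³ standard) x y) → SubspaceIn x y (φ³ standard)
    lift x y basis′ with basisOfSide⇒covers (φ³ standard) x y basis′
    ... | x-covered , y-covered with covers-image standard x x-covered | covers-image standard y y-covered
    ... | u , refl | w , refl =
      subspaceInᵇ⇒SubspaceIn (φ³ standard)
        (subst T (sym (subspaceInᵇ-φ standard u w))
          (standard-basis⇒subspace u w (subst T (basisOfSide-φ standard u w) basis′)))

covered-count : ∀ {n} (t : Triple n) → IsTriangle t → ∑V n (λ x → 𝟙 (nonzero x ∧ covers t x)) ≡ 6
covered-count (a , b , c) = Embedding.covered-count a b c

basis-count : ∀ {n} (t : Triple n) → IsTriangle t → ∑V n (λ x → ∑V n (λ y → 𝟙 (basisOfSide t x y))) ≡ 18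
basis-count (a , b , c) = Embedding.basis-count a b c

basisOfSide⇒SubspaceIn : ∀ {n} (t : Triple n) → IsTriangle t → ∀ x y → T (basisOfSide t x y) → SubspaceIn x y t
basisOfSide⇒SubspaceIn (a , b , c) = Embedding.basisOfSide⇒SubspaceIn a b c

#nonzero : ℕ → ℕ
#nonzero n = ∑V n (𝟙 ∘ nonzero)

suc-#nonzero : ∀ n → suc (#nonzero n) ≡ 2 ^ n
suc-#nonzero n = begin
  suc (#nonzero n)
    ≡⟨ +-comm 1 (#nonzero n) ⟩
  #nonzero n + 1
    ≡⟨ cong (#nonzero n +_) (sym (∑V-𝟙-== n 0v)) ⟩
  #nonzero n + ∑V n (λ x → 𝟙 (0v == x))
    ≡⟨ sym (∑V-distrib-+ n _ _) ⟩
  ∑V n (λ x → 𝟙 (nonzero x) + 𝟙 (0v == x))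
    ≡⟨ ∑V-cong n (λ x → cong (λ b → 𝟙 (not b) + 𝟙 (0v == x)) (==-sym x 0v)) ⟩
  ∑V n (λ x → 𝟙 (not (0v == x)) + 𝟙 (0v == x))
    ≡⟨ ∑V-cong n (λ x → 𝟙-not+𝟙 (0v == x)) ⟩
  ∑V n (λ _ → 1)
    ≡⟨ ∑V-one n ⟩
  2 ^ n ∎
  where
  open ≡-Reasoning
  𝟙-not+𝟙 : ∀ b → 𝟙 (not b) + 𝟙 b ≡ 1
  𝟙-not+𝟙 true  = refl
  𝟙-not+𝟙 false = refl

suc-#other-nonzero : ∀ {n} (x : V n) → T (nonzero x) →
                     suc (∑V n (λ y → 𝟙 (nonzero y ∧ not (x == y)))) ≡ #nonzero n
suc-#other-nonzero {n} x x≠0 = begin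
  suc others                                                ≡⟨ +-comm 1 others ⟩
  others + 1                                                ≡⟨ cong (others +_) (sym (∑V-𝟙-== n x)) ⟩
  others + ∑V n (λ y → 𝟙 (x == y))                          ≡⟨ sym (∑V-distrib-+ n _ _) ⟩
  ∑V n (λ y → 𝟙 (nonzero y ∧ not (x == y)) + 𝟙 (x == y))    ≡⟨ ∑V-cong n split ⟨
  #nonzero n                                                ∎
  where
  open ≡-Reasoning
  others = ∑V n (λ y → 𝟙 (nonzero y ∧ not (x == y)))
  split : ∀ y → 𝟙 (nonzero y) ≡ 𝟙 (nonzero y ∧ not (x == y)) + 𝟙 (x == y)
  split y =
    𝟙-split (nonzero y) (x == y) (λ x==y → subst (λ (z : V n) → T (nonzero z)) (==⇒≡ {x = x} {y} x==y) x≠0)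

independent-pair-count-by-vectors : ∀ n →
  ∑V n (λ x → ∑V n (λ y → 𝟙 (independent x y))) ≡ #nonzero n * (#nonzero n ∸ 1)
independent-pair-count-by-vectors n = trans (∑V-cong n partners) (∑V-*ʳ n (𝟙 ∘ nonzero) (#nonzero n ∸ 1))
  where
  partners : ∀ x → ∑V n (λ y → 𝟙 (independent x y)) ≡ 𝟙 (nonzero x) * (#nonzero n ∸ 1)
  partners x = trans (∑V-𝟙-∧ n (nonzero x) _)
                     (𝟙-*-cong (nonzero x) (cong (_∸ 1) ∘ suc-#other-nonzero x))

module Design {n m} (𝒯 : Fin m → Triple n) (design : IsTriangleDesign 𝒯) where

  triangles : ∀ i → IsTriangle (𝒯 i)
  triangles = proj₁ design

  #triangles-through≡1 : ∀ x y → T (independent x y) → sum (λ i → 𝟙 (inSubspaceOf (𝒯 i) x y)) ≡ 1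
  #triangles-through≡1 x y indep with proj₂ design x y (independent⇒LinIndep x y indep)
  ... | (i , x,y∈𝒯i) , unique =
    trans (sum-point _ i (λ j j≢i → 𝟙-¬T _ (j≢i ∘ other j)))
          (𝟙-T _ (SubspaceIn⇒inSubspaceOf (𝒯 i) x,y∈𝒯i))
    where
    other : ∀ j → T (inSubspaceOf (𝒯 j) x y) → j ≡ i
    other j x,y∈𝒯j = unique j i
      (basisOfSide⇒SubspaceIn (𝒯 j) (triangles j) x y (from (T-∧ {independent x y}) (indep , x,y∈𝒯j)))
      x,y∈𝒯i

  independent-pair-count-by-triangles : ∑V n (λ x → ∑V n (λ y → 𝟙 (independent x y))) ≡ m * 18
  independent-pair-count-by-triangles = begin
    ∑V n (λ x → ∑V n (λ y → 𝟙 (independent x y)))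
      ≡⟨ ∑V-cong n (λ x → ∑V-cong n (one-triangle x)) ⟩
    ∑V n (λ x → ∑V n (λ y → sum (λ i → 𝟙 (basisOfSide (𝒯 i) x y))))
      ≡⟨ ∑V-cong n (λ x → ∑V-sum-comm n (λ y i → 𝟙 (basisOfSide (𝒯 i) x y))) ⟩
    ∑V n (λ x → sum (λ i → ∑V n (λ y → 𝟙 (basisOfSide (𝒯 i) x y))))
      ≡⟨ ∑V-sum-comm n (λ x i → ∑V n (λ y → 𝟙 (basisOfSide (𝒯 i) x y))) ⟩
    sum (λ i → ∑V n (λ x → ∑V n (λ y → 𝟙 (basisOfSide (𝒯 i) x y))))
      ≡⟨ sum-cong-≗ (λ i → basis-count (𝒯 i) (triangles i)) ⟩
    sum {m} (λ _ → 18)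
      ≡⟨ sum-const m 18 ⟩
    m * 18 ∎
    where
    open ≡-Reasoning
    one-triangle : ∀ x y → 𝟙 (independent x y) ≡ sum (λ i → 𝟙 (basisOfSide (𝒯 i) x y))
    one-triangle x y = sym (trans (sum-𝟙-∧ (independent x y) (λ i → inSubspaceOf (𝒯 i) x y))
                                  (trans (𝟙-*-cong (independent x y) (#triangles-through≡1 x y)) (*-identityʳ _)))

  cover-count-by-triangles : ∑V n (λ x → 𝟙 (nonzero x) * coverCount 𝒯 x) ≡ m * 6
  cover-count-by-triangles = begin
    ∑V n (λ x → 𝟙 (nonzero x) * coverCount 𝒯 x)
      ≡⟨ ∑V-cong n (λ x → cong (𝟙 (nonzero x) *_) (count≡sum (λ i → covers (𝒯 i) x))) ⟩
    ∑V n (λ x → 𝟙 (nonzero x) * sum (λ i → 𝟙 (covers (𝒯 i) x)))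
      ≡⟨ ∑V-cong n (λ x → sum-𝟙-∧ (nonzero x) (λ i → covers (𝒯 i) x)) ⟨
    ∑V n (λ x → sum (λ i → 𝟙 (nonzero x ∧ covers (𝒯 i) x)))
      ≡⟨ ∑V-sum-comm n (λ x i → 𝟙 (nonzero x ∧ covers (𝒯 i) x)) ⟩
    sum (λ i → ∑V n (λ x → 𝟙 (nonzero x ∧ covers (𝒯 i) x)))
      ≡⟨ sum-cong-≗ (λ i → covered-count (𝒯 i) (triangles i)) ⟩
    sum {m} (λ _ → 6)
      ≡⟨ sum-const m 6 ⟩
    m * 6 ∎
    where open ≡-Reasoning

  double-count : ∀ {k} → (∀ x → x ≢ 0v → coverCount 𝒯 x ≡ k) →
                 #nonzero n * (k * 3) ≡ #nonzero n * (#nonzero n ∸ 1)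
  double-count {k} balanced = begin
    N * (k * 3)                                      ≡⟨ *-assoc N k 3 ⟨
    N * k * 3                                        ≡⟨ cong (_* 3) cover-counts ⟩
    m * 6 * 3                                        ≡⟨ *-assoc m 6 3 ⟩
    m * 18                                           ≡⟨ independent-pair-count-by-triangles ⟨
    ∑V n (λ x → ∑V n (λ y → 𝟙 (independent x y)))    ≡⟨ independent-pair-count-by-vectors n ⟩
    N * (N ∸ 1)                                      ∎
    where
    open ≡-Reasoning
    N = #nonzero n
    cover-count-by-vectors : ∑V n (λ x → 𝟙 (nonzero x) * coverCount 𝒯 x) ≡ N * k
    cover-count-by-vectors =
      trans (∑V-cong n (λ x → 𝟙-*-cong (nonzero x) (balanced x ∘ not-==⇒≢))) (∑V-*ʳ n (𝟙 ∘ nonzero) k)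
    cover-counts : N * k ≡ m * 6
    cover-counts = trans (sym cover-count-by-vectors) cover-count-by-triangles

m*[k*3]≡m*[m∸1]⇒suc[m]≡2+k*3 : ∀ {m k} → 2 ≤ suc m → m * (k * 3) ≡ m * (m ∸ 1) → suc m ≡ 2 + k * 3
m*[k*3]≡m*[m∸1]⇒suc[m]≡2+k*3 {zero}  (s≤s ())
m*[k*3]≡m*[m∸1]⇒suc[m]≡2+k*3 {suc m} {k} _ eq = cong (2 +_) (sym (*-cancelˡ-≡ (k * 3) m (suc m) eq))

2^[2+n]%3≡2^n%3 : ∀ n → 2 ^ (2 + n) % 3 ≡ 2 ^ n % 3
2^[2+n]%3≡2^n%3 n = trans (cong (_% 3) (4x≡x+x*3 (2 ^ n))) ([m+kn]%n≡m%n (2 ^ n) (2 ^ n) 3)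
  where
  4x≡x+x*3 : ∀ x → 2 * (2 * x) ≡ x + x * 3
  4x≡x+x*3 = solve-∀

2^n%3≡2⇒Odd : ∀ n → 2 ^ n % 3 ≡ 2 → Odd n
2^n%3≡2⇒Odd zero          ()
2^n%3≡2⇒Odd (suc zero)    _ = 0 , refl
2^n%3≡2⇒Odd (suc (suc n)) 2^[2+n]%3≡2 with 2^n%3≡2⇒Odd n (trans (sym (2^[2+n]%3≡2^n%3 n)) 2^[2+n]%3≡2)
... | j , refl = suc j , cong suc (sym (*-suc 2 j))

lemma1 : (n : ℕ) → 1 ≤ n → (m : ℕ) → (T : Fin m → Triple n) →
    IsTriangleDesign T → IsBalanced T →
    Odd n × ((x : V n) → ¬ (x ≡ 0v) → coverCount T x ≡ (2 ^ n ∸ 2) / 3)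
lemma1 n n≥1 m 𝒯 design (k , balanced) =
  2^n%3≡2⇒Odd n 2^n%3≡2 , λ x x≢0 → trans (balanced x x≢0) k≡[2^n∸2]/3
  where
  2≤suc[#nonzero] : 2 ≤ suc (#nonzero n)
  2≤suc[#nonzero] = subst (2 ≤_) (sym (suc-#nonzero n)) (^-monoʳ-≤ 2 n≥1)
  2^n≡2+k*3 : 2 ^ n ≡ 2 + k * 3
  2^n≡2+k*3 = trans (sym (suc-#nonzero n))
    (m*[k*3]≡m*[m∸1]⇒suc[m]≡2+k*3 {k = k} 2≤suc[#nonzero] (Design.double-count 𝒯 design balanced))
  2^n%3≡2 : 2 ^ n % 3 ≡ 2
  2^n%3≡2 = trans (cong (_% 3) 2^n≡2+k*3) ([m+kn]%n≡m%n 2 k 3)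
  k≡[2^n∸2]/3 : k ≡ (2 ^ n ∸ 2) / 3
  k≡[2^n∸2]/3 = sym (begin
    (2 ^ n ∸ 2) / 3        ≡⟨ cong (λ e → (e ∸ 2) / 3) 2^n≡2+k*3 ⟩
    (2 + k * 3 ∸ 2) / 3    ≡⟨ cong (_/ 3) (m+n∸m≡n 2 (k * 3)) ⟩
    k * 3 / 3              ≡⟨ m*n/n≡m k 3 ⟩
    k                      ∎)
    where open ≡-Reasoning
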